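{- Let $\mathcal{S}=[0,C_1]\times\cdots\times[0,C_d]\subset\mathbb{Z}^d$ with the componentwise order, let $\mathcal{B}\subseteq\{1,\dots,d\}$, and let $a$ be an ASHE with direction vector $v$ and blocking relation $\mathcal{R}=\{(i,i): i\in\mathcal{B}\}$. For $m,M\in\mathcal{S}$ with $m\le M$, writing $[m',M']=[m,M]\boxdot a$, we have $$\|M'-m'\|_1\le\sum_{i\notin\mathcal{B}}(M_i-m_i)+\sum_{i\in\mathcal{B}}\max\{M_i-m_i,\ |v_i|-1\}=\|M-m\|_1+\sum_{i\in\mathcal{B}}\max\{|v_i|-M_i+m_i-1,\ 0\}.$$
   Context: For $x\in\mathcal{S}$: $CR(x)=\{i: x_i+v_i\notin[0,C_i]\}$ and $B(x)=\{i:\exists j\in CR(x),\ (j,i)\in\mathcal{R}\}$. An event $a$ is an ASHE with direction vector $v\in\mathbb{Z}^d$ and blocking relation $\mathcal{R}$ (a binary relation on $\{1,\dots,d\}$) if for all $x\in\mathcal{S}$ and all $i$: $(x\cdot a)_i=x_i$ if $i\in B(x)$ and $(x\cdot a)_i=\min(\max(x_i+v_i,0),C_i)$ otherwise. $[m,M]=\{x\in\mathcal{S}: m\le x\le M\}$, and $[m,M]\boxdot a=[\inf_{x\in[m,M]}x\cdot a,\ \sup_{x\in[m,M]}x\cdot a]$ (componentwise inf/sup). $\|y\|_1=\sum_i|y_i|$. -}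

module Defs where

open import Data.Nat using (ℕ; zero; suc)
open import Data.Fin using (Fin; zero; suc)
open import Data.Integer using (ℤ; +_; _+_; _-_; _≤_; _⊔_; _⊓_; ∣_∣; 0ℤ; 1ℤ)
open import Data.Product using (Σ; _×_)
open import Data.Bool using (Bool; true; false; T; if_then_else_)
open import Relation.Nullary using (¬_)
open import Relation.Binary.PropositionalEquality using (_≡_)

Pt : ℕ → Set
Pt d = Fin d → ℤ

Σᶠ : ∀ {n} → (Fin n → ℤ) → ℤ
Σᶠ {zero}  f = 0ℤ
Σᶠ {suc n} f = f zero + Σᶠ (λ i → f (suc i))

‖_‖₁ : ∀ {d} → Pt d → ℤ
‖ y ‖₁ = Σᶠ (λ i → + ∣ y i ∣)

InS : ∀ {d} → (C : Fin d → ℕ) → Pt d → Set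
InS C x = ∀ i → (0ℤ ≤ x i) × (x i ≤ + C i)

_≤ᵖ_ : ∀ {d} → Pt d → Pt d → Set
x ≤ᵖ y = ∀ i → x i ≤ y i

InBox : ∀ {d} → (C : Fin d → ℕ) → Pt d → Pt d → Pt d → Set
InBox C m M x = InS C x × (m ≤ᵖ x) × (x ≤ᵖ M)

CR : ∀ {d} → (C : Fin d → ℕ) → (v : Pt d) → Pt d → Fin d → Set
CR C v x i = ¬ ((0ℤ ≤ x i + v i) × (x i + v i ≤ + C i))

Blocked : ∀ {d} → (C : Fin d → ℕ) → (v : Pt d) → (R : Fin d → Fin d → Set) →
          Pt d → Fin d → Set
Blocked C v R x i = Σ (Fin _) (λ j → CR C v x j × R j i)

clamp : ∀ {d} → (C : Fin d → ℕ) → (v : Pt d) → Pt d → Fin d → ℤ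
clamp C v x i = ((x i + v i) ⊔ 0ℤ) ⊓ + C i

-- an event a (acting on states, x ↦ x · a) is an ASHE with direction v
-- and blocking relation R
IsASHE : ∀ {d} → (C : Fin d → ℕ) → (v : Pt d) → (R : Fin d → Fin d → Set) →
         (Pt d → Pt d) → Set
IsASHE C v R act =
  ∀ x → InS C x → ∀ i →
    (Blocked C v R x i → act x i ≡ x i) ×
    (¬ Blocked C v R x i → act x i ≡ clamp C v x i)

diagRel : ∀ {d} → (Fin d → Bool) → Fin d → Fin d → Set
diagRel 𝓑 j i = (j ≡ i) × T (𝓑 i)

IsInfAt : ∀ {d} → (C : Fin d → ℕ) → (Pt d → Pt d) → Pt d → Pt d → Fin d → ℤ → Set
IsInfAt C act m M i l =
  (∀ x → InBox C m M x → l ≤ act x i) ×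
  (∀ l' → (∀ x → InBox C m M x → l' ≤ act x i) → l' ≤ l)

IsSupAt : ∀ {d} → (C : Fin d → ℕ) → (Pt d → Pt d) → Pt d → Pt d → Fin d → ℤ → Set
IsSupAt C act m M i u =
  (∀ x → InBox C m M x → act x i ≤ u) ×
  (∀ u' → (∀ x → InBox C m M x → act x i ≤ u') → u ≤ u')

IsBoxImage : ∀ {d} → (C : Fin d → ℕ) → (Pt d → Pt d) → Pt d → Pt d → Pt d → Pt d → Set
IsBoxImage C act m M m' M' = ∀ i → IsInfAt C act m M i (m' i) × IsSupAt C act m M i (M' i)

module Submission where

-- The argument is coordinatewise.  For a coordinate i we bound the spread
-- (x·a)_i - (y·a)_i over all pairs x, y of the box by a constant K_i; the
-- width M'_i - m'_i of the image interval, being sup minus inf, is then at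
-- most K_i (`image-width-≤`).  Unblocked coordinates are moved by a clamp,
-- which is 1-Lipschitz, so K_i = M_i - m_i.  Self-blocked coordinates either
-- move by v_i or stay put; comparing the mixed cases (one point moves, the
-- other is blocked) gives K_i = max{M_i - m_i, |v_i| - 1}
-- (`self-blocked-spread`).  Summing over coordinates gives the inequality,
-- and the equality is the identity max{a, b} = a + max{b - a, 0} summed.

open import Defs
open import Data.Nat using (ℕ; zero; suc)
open import Data.Fin using (Fin; zero; suc)
open import Data.Integer using (ℤ; +_; _+_; _-_; -_; _≤_; _<_; _⊔_; _⊓_; ∣_∣; 0ℤ; 1ℤ; pred)
open import Data.Integer.Properties
open import Data.Integer.Tactic.RingSolver using (solve-∀)
open import Data.Bool using (Bool; true; false; T; if_then_else_)
open import Data.Unit using (tt)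
open import Data.Product using (_×_; _,_; proj₁; proj₂)
open import Relation.Nullary using (¬_; Dec; yes; no)
open import Relation.Nullary.Decidable using (_×-dec_)
open import Relation.Binary.PropositionalEquality
  using (_≡_; refl; sym; trans; cong; cong₂; subst; subst₂; module ≡-Reasoning)
open import Function using (_∘_)

≤-slack : ∀ {a δ K} b → a ≤ b + δ → δ ≤ K → a ≤ b + K
≤-slack b a≤b+δ δ≤K = ≤-trans a≤b+δ (+-monoʳ-≤ b δ≤K)

≤-+-nonneg : ∀ {δ} → 0ℤ ≤ δ → ∀ a → a ≤ a + δ
≤-+-nonneg 0≤δ a = ≤-trans (≤-reflexive (sym (+-identityʳ a))) (+-monoʳ-≤ a 0≤δ)

+-nonpos-≤ : ∀ {w} → w ≤ 0ℤ → ∀ a → a + w ≤ a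
+-nonpos-≤ w≤0 a = ≤-trans (+-monoʳ-≤ a w≤0) (≤-reflexive (+-identityʳ a))

<⇒≤-1 : ∀ {i} j → i < j → i ≤ j - 1ℤ
<⇒≤-1 j i<j = ≤-trans (i<j⇒i≤pred[j] i<j) (≤-reflexive (+-comm (pred 0ℤ) j))

+-cancelʳ-< : ∀ {x y} w → x + w < y + w → x < y
+-cancelʳ-< {x} {y} w = subst₂ _<_ (add-sub x w) (add-sub y w) ∘ +-monoˡ-< (- w)
  where
  add-sub : ∀ a b → (a + b) - b ≡ a
  add-sub = solve-∀

+-shift-≤ : ∀ {x δ} y w → x ≤ y + δ → x + w ≤ (y + w) + δ
+-shift-≤ {δ = δ} y w x≤y+δ =
  ≤-trans (+-monoˡ-≤ w x≤y+δ) (≤-reflexive (swap y δ w))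
  where
  swap : ∀ a b c → (a + b) + c ≡ (a + c) + b
  swap = solve-∀

≤-+-subst : ∀ {a b a' b' K} → a' ≡ a → b' ≡ b → a ≤ b + K → a' ≤ b' + K
≤-+-subst refl refl a≤b+K = a≤b+K

⊔-as-excess : ∀ a b → a ⊔ b ≡ a + ((b - a) ⊔ 0ℤ)
⊔-as-excess a b = begin
  a ⊔ b                        ≡⟨ ⊔-comm a b ⟩
  b ⊔ a                        ≡⟨ sym (cong₂ _⊔_ (a+[b-a]≡b a b) (+-identityʳ a)) ⟩
  (a + (b - a)) ⊔ (a + 0ℤ)     ≡⟨ sym (mono-≤-distrib-⊔ (+-monoʳ-≤ a) (b - a) 0ℤ) ⟩
  a + ((b - a) ⊔ 0ℤ)           ∎
  where
  open ≡-Reasoning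
  a+[b-a]≡b : ∀ a b → a + (b - a) ≡ b
  a+[b-a]≡b = solve-∀

Σᶠ-mono : ∀ {n} {f g : Fin n → ℤ} → (∀ i → f i ≤ g i) → Σᶠ f ≤ Σᶠ g
Σᶠ-mono {zero}  f≤g = ≤-refl
Σᶠ-mono {suc n} f≤g = +-mono-≤ (f≤g zero) (Σᶠ-mono (f≤g ∘ suc))

Σᶠ-cong : ∀ {n} {f g : Fin n → ℤ} → (∀ i → f i ≡ g i) → Σᶠ f ≡ Σᶠ g
Σᶠ-cong {zero}  f≡g = refl
Σᶠ-cong {suc n} f≡g = cong₂ _+_ (f≡g zero) (Σᶠ-cong (f≡g ∘ suc))

Σᶠ-+ : ∀ {n} (f g : Fin n → ℤ) → Σᶠ (λ i → f i + g i) ≡ Σᶠ f + Σᶠ g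
Σᶠ-+ {zero}  f g = refl
Σᶠ-+ {suc n} f g = trans (cong (_+_ (f zero + g zero)) (Σᶠ-+ (f ∘ suc) (g ∘ suc)))
                         (interchange (f zero) (g zero) (Σᶠ (f ∘ suc)) (Σᶠ (g ∘ suc)))
  where
  interchange : ∀ a b c d → (a + b) + (c + d) ≡ (a + c) + (b + d)
  interchange = solve-∀

-- If any two values (x·a)_i, (y·a)_i over the box differ by at most K,
-- then so do their supremum u and infimum l: u - K is a lower bound.
image-width-≤ : ∀ {d} {C : Fin d → ℕ} {act : Pt d → Pt d} {m M : Pt d} {i l u K} →
  IsInfAt C act m M i l → IsSupAt C act m M i u →
  (∀ x y → InBox C m M x → InBox C m M y → act x i ≤ act y i + K) →
  u - l ≤ K
image-width-≤ {act = act} {i = i} {l} {u} {K} (_ , l-greatest) (_ , u-least) spread =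
  shift (l-greatest (u - K) λ y y∈box →
    unshift (u-least (act y i + K) λ x x∈box → spread x y x∈box y∈box))
  where
  unshift : ∀ {a b} → a ≤ b + K → a - K ≤ b
  unshift {a} {b} a≤b+K = ≤-trans (+-monoˡ-≤ (- K) a≤b+K) (≤-reflexive (add-sub b K))
    where add-sub : ∀ a b → (a + b) - b ≡ a
          add-sub = solve-∀
  shift : u - K ≤ l → u - l ≤ K
  shift u-K≤l = i-j≤0⇒i≤j (≤-trans (≤-reflexive (regroup u l K))
                                   (i≤j⇒i-j≤0 u-K≤l))
    where regroup : ∀ u l K → (u - l) - K ≡ (u - K) - l
          regroup = solve-∀

image-width-nonneg : ∀ {d} {C : Fin d → ℕ} {act : Pt d → Pt d} {m M z : Pt d} {i l u} →
  IsInfAt C act m M i l → IsSupAt C act m M i u → InBox C m M z → 0ℤ ≤ u - l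
image-width-nonneg {z = z} (l-lower , _) (u-upper , _) z∈box =
  i≤j⇒0≤j-i (≤-trans (l-lower z z∈box) (u-upper z z∈box))

box-spread : ∀ {d} {C : Fin d → ℕ} {m M x y : Pt d} i →
  InBox C m M x → InBox C m M y → x i ≤ y i + (M i - m i)
box-spread {m = m} {M} {x} {y} i (_ , _ , x≤M) (_ , m≤y , _) = begin
  x i                  ≤⟨ x≤M i ⟩
  M i                  ≡⟨ sym (a+[b-a]≡b (m i) (M i)) ⟩
  m i + (M i - m i)    ≤⟨ +-monoˡ-≤ (M i - m i) (m≤y i) ⟩
  y i + (M i - m i)    ∎
  where
  open ≤-Reasoning
  a+[b-a]≡b : ∀ a b → a + (b - a) ≡ b
  a+[b-a]≡b = solve-∀

⊔-lipschitz : ∀ {p q δ} r → 0ℤ ≤ δ → p ≤ q + δ → p ⊔ r ≤ (q ⊔ r) + δ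
⊔-lipschitz {p} {q} {δ} r 0≤δ p≤q+δ = begin
  p ⊔ r              ≤⟨ ⊔-mono-≤ p≤q+δ (≤-+-nonneg 0≤δ r) ⟩
  (q + δ) ⊔ (r + δ)  ≡⟨ sym (mono-≤-distrib-⊔ (+-monoˡ-≤ δ) q r) ⟩
  (q ⊔ r) + δ        ∎
  where open ≤-Reasoning

⊓-lipschitz : ∀ {p q δ} r → 0ℤ ≤ δ → p ≤ q + δ → p ⊓ r ≤ (q ⊓ r) + δ
⊓-lipschitz {p} {q} {δ} r 0≤δ p≤q+δ = begin
  p ⊓ r              ≤⟨ ⊓-mono-≤ p≤q+δ (≤-+-nonneg 0≤δ r) ⟩
  (q + δ) ⊓ (r + δ)  ≡⟨ sym (mono-≤-distrib-⊓ (+-monoˡ-≤ δ) q r) ⟩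
  (q ⊓ r) + δ        ∎
  where open ≤-Reasoning

clamp-lipschitz : ∀ {d} (C : Fin d → ℕ) (v : Pt d) {x y : Pt d} {δ} i → 0ℤ ≤ δ →
  x i ≤ y i + δ → clamp C v x i ≤ clamp C v y i + δ
clamp-lipschitz C v {x} {y} {δ} i 0≤δ x≤y+δ =
  ⊓-lipschitz {q = (y i + v i) ⊔ 0ℤ} (+ C i) 0≤δ
    (⊔-lipschitz {q = y i + v i} 0ℤ 0≤δ (+-shift-≤ (y i) (v i) x≤y+δ))

clamp-in-range : ∀ {c p} → 0ℤ ≤ p → p ≤ c → (p ⊔ 0ℤ) ⊓ c ≡ p
clamp-in-range {c} 0≤p p≤c = trans (cong (_⊓ c) (i≥j⇒i⊔j≡i 0≤p)) (i≤j⇒i⊓j≡i p≤c)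

InRange : ℤ → ℤ → Set
InRange c p = (0ℤ ≤ p) × (p ≤ c)

inRange? : ∀ c p → Dec (InRange c p)
inRange? c p = (0ℤ ≤? p) ×-dec (p ≤? c)

SelfBlockedMove : (c w p q : ℤ) → Set
SelfBlockedMove c w p q =
  (InRange c (p + w) → q ≡ p + w) × (¬ InRange c (p + w) → q ≡ p)

+∣w∣≡-w : ∀ {w} → w ≤ 0ℤ → + ∣ w ∣ ≡ - w
+∣w∣≡-w {w} w≤0 = trans (cong +_ (sym (∣-i∣≡∣i∣ w))) (0≤i⇒+∣i∣≡i (neg-mono-≤ w≤0))

-- Mixed case: x moves while y is blocked.  For w ≤ 0 moving only
-- decreases x; for w > 0, y is blocked above c ≥ x + w, so x + w falls
-- short of y + w by at least one.
moving-vs-blocked : ∀ {c w x y δ} → 0ℤ ≤ y → x ≤ y + δ →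
  InRange c (x + w) → ¬ InRange c (y + w) → x + w ≤ y + (δ ⊔ (+ ∣ w ∣ - 1ℤ))
moving-vs-blocked {c} {w} {x} {y} {δ} 0≤y x≤y+δ (_ , x+w≤c) y-blocked with w ≤? 0ℤ
... | yes w≤0 = ≤-slack y (≤-trans (+-nonpos-≤ w≤0 x) x≤y+δ) (i≤i⊔j δ _)
... | no w≰0  = ≤-slack y x+w≤y+∣w∣-1 (i≤j⊔i δ _)
  where
  0≤w : 0ℤ ≤ w
  0≤w = <⇒≤ (≰⇒> w≰0)
  c<y+w : c < y + w
  c<y+w = ≰⇒> λ y+w≤c → y-blocked (+-mono-≤ 0≤y 0≤w , y+w≤c)
  regroup : ∀ y w → (y + w) - 1ℤ ≡ y + (w - 1ℤ)
  regroup = solve-∀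
  x+w≤y+∣w∣-1 : x + w ≤ y + (+ ∣ w ∣ - 1ℤ)
  x+w≤y+∣w∣-1 = ≤-trans (<⇒≤-1 (y + w) (≤-<-trans x+w≤c c<y+w))
    (≤-reflexive (trans (regroup y w) (cong (λ k → y + (k - 1ℤ)) (sym (0≤i⇒+∣i∣≡i 0≤w)))))

-- Mixed case: x is blocked while y moves.  For w ≥ 0 moving only
-- increases y; for w < 0, x is blocked below 0 ≤ y + w, so x < y.
blocked-vs-moving : ∀ {c w x y δ} → x ≤ c → x ≤ y + δ →
  ¬ InRange c (x + w) → InRange c (y + w) → x ≤ (y + w) + (δ ⊔ (+ ∣ w ∣ - 1ℤ))
blocked-vs-moving {c} {w} {x} {y} {δ} x≤c x≤y+δ x-blocked (0≤y+w , _) with 0ℤ ≤? w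
... | yes 0≤w = ≤-slack (y + w) (≤-trans x≤y+δ (+-monoˡ-≤ δ (≤-+-nonneg 0≤w y))) (i≤i⊔j δ _)
... | no 0≰w  = ≤-slack (y + w) x≤y+w+∣w∣-1 (i≤j⊔i δ _)
  where
  w≤0 : w ≤ 0ℤ
  w≤0 = <⇒≤ (≰⇒> 0≰w)
  x+w<0 : x + w < 0ℤ
  x+w<0 = ≰⇒> λ 0≤x+w → x-blocked (0≤x+w , ≤-trans (+-nonpos-≤ w≤0 x) x≤c)
  regroup : ∀ y w → y - 1ℤ ≡ (y + w) + (- w - 1ℤ)
  regroup = solve-∀
  x≤y+w+∣w∣-1 : x ≤ (y + w) + (+ ∣ w ∣ - 1ℤ)
  x≤y+w+∣w∣-1 = ≤-trans (<⇒≤-1 y (+-cancelʳ-< w (<-≤-trans x+w<0 0≤y+w)))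
    (≤-reflexive (trans (regroup y w) (cong (λ k → (y + w) + (k - 1ℤ)) (sym (+∣w∣≡-w w≤0)))))

-- Two self-blocking moves of points at distance ≤ δ end up at distance
-- ≤ max{δ, |w| - 1}: equal behaviour preserves the distance, and the
-- mixed cases are the two lemmas above.
self-blocked-spread : ∀ {c w x y δ x' y'} → 0ℤ ≤ y → x ≤ c → x ≤ y + δ →
  SelfBlockedMove c w x x' → SelfBlockedMove c w y y' →
  x' ≤ y' + (δ ⊔ (+ ∣ w ∣ - 1ℤ))
self-blocked-spread {c} {w} {x} {y} {δ} 0≤y x≤c x≤y+δ (x-moves , x-stays) (y-moves , y-stays)
  with inRange? c (x + w) | inRange? c (y + w)
... | yes x∈ | yes y∈ = ≤-+-subst (x-moves x∈) (y-moves y∈) (≤-slack (y + w) (+-shift-≤ y w x≤y+δ) (i≤i⊔j δ _))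
... | yes x∈ | no  y∉ = ≤-+-subst (x-moves x∈) (y-stays y∉) (moving-vs-blocked 0≤y x≤y+δ x∈ y∉)
... | no  x∉ | yes y∈ = ≤-+-subst (x-stays x∉) (y-moves y∈) (blocked-vs-moving {y = y} x≤c x≤y+δ x∉ y∈)
... | no  x∉ | no  y∉ = ≤-+-subst (x-stays x∉) (y-stays y∉) (≤-slack y x≤y+δ (i≤i⊔j δ _))

spreadBound : ∀ {d} → (Fin d → Bool) → (v m M : Pt d) → Fin d → ℤ
spreadBound 𝓑 v m M i = if 𝓑 i then (M i - m i) ⊔ (+ ∣ v i ∣ - 1ℤ) else (M i - m i)

module _ {d} {C : Fin d → ℕ} {𝓑 : Fin d → Bool} {v : Pt d} {act : Pt d → Pt d}
         (ashe : IsASHE C v (diagRel 𝓑) act) where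

  unblocked-coordinate : ∀ {x} i → 𝓑 i ≡ false → InS C x → act x i ≡ clamp C v x i
  unblocked-coordinate {x} i i∉𝓑 x∈S =
    proj₂ (ashe x x∈S i) λ { (_ , _ , refl , i∈𝓑) → subst T i∉𝓑 i∈𝓑 }

  self-blocked-coordinate : ∀ {x} i → 𝓑 i ≡ true → InS C x →
    SelfBlockedMove (+ C i) (v i) (x i) (act x i)
  self-blocked-coordinate {x} i i∈𝓑 x∈S = moves , stays
    where
    moves : InRange (+ C i) (x i + v i) → act x i ≡ x i + v i
    moves (0≤ , ≤C) = trans (proj₂ (ashe x x∈S i) λ { (_ , critical , refl , _) → critical (0≤ , ≤C) })
                            (clamp-in-range 0≤ ≤C)
    stays : ¬ InRange (+ C i) (x i + v i) → act x i ≡ x i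
    stays critical = proj₁ (ashe x x∈S i) (i , critical , refl , subst T (sym i∈𝓑) tt)

  coordinate-spread : ∀ {m M x y} i → InBox C m M x → InBox C m M y →
    act x i ≤ act y i + spreadBound 𝓑 v m M i
  coordinate-spread {x = x} {y} i x∈box@(x∈S , m≤x , x≤M) y∈box@(y∈S , _) with 𝓑 i in eq
  ... | true  = self-blocked-spread (proj₁ (y∈S i)) (proj₂ (x∈S i)) (box-spread i x∈box y∈box)
                  (self-blocked-coordinate i eq x∈S) (self-blocked-coordinate i eq y∈S)
  ... | false = ≤-+-subst (unblocked-coordinate i eq x∈S) (unblocked-coordinate i eq y∈S)
                  (clamp-lipschitz C v {x} {y} i (i≤j⇒0≤j-i (≤-trans (m≤x i) (x≤M i)))
                     (box-spread i x∈box y∈box))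

spreadBound-split : ∀ {d} (𝓑 : Fin d → Bool) (v m M : Pt d) i → m i ≤ M i →
  spreadBound 𝓑 v m M i
    ≡ + ∣ M i - m i ∣ + (if 𝓑 i then ((+ ∣ v i ∣ - M i) + m i - 1ℤ) ⊔ 0ℤ else 0ℤ)
spreadBound-split 𝓑 v m M i m≤M rewrite 0≤i⇒+∣i∣≡i (i≤j⇒0≤j-i m≤M) with 𝓑 i
... | true  = trans (⊔-as-excess (M i - m i) _)
                    (cong (λ e → (M i - m i) + (e ⊔ 0ℤ)) (regroup (+ ∣ v i ∣) (M i) (m i)))
  where
  regroup : ∀ u M m → (u - 1ℤ) - (M - m) ≡ (u - M) + m - 1ℤ
  regroup = solve-∀
... | false = sym (+-identityʳ (M i - m i))

proposition2 : (d : ℕ) (C : Fin d → ℕ) (𝓑 : Fin d → Bool) (v : Pt d) (act : Pt d → Pt d) →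
    IsASHE C v (diagRel 𝓑) act →
    (m M : Pt d) → InS C m → InS C M → m ≤ᵖ M →
    (m' M' : Pt d) → IsBoxImage C act m M m' M' →
    (‖ (λ i → M' i - m' i) ‖₁
       ≤ Σᶠ (λ i → if 𝓑 i then (M i - m i) ⊔ (+ ∣ v i ∣ - 1ℤ) else (M i - m i)))
    × (Σᶠ (λ i → if 𝓑 i then (M i - m i) ⊔ (+ ∣ v i ∣ - 1ℤ) else (M i - m i))
       ≡ ‖ (λ i → M i - m i) ‖₁
         + Σᶠ (λ i → if 𝓑 i then ((+ ∣ v i ∣ - M i) + m i - 1ℤ) ⊔ 0ℤ else 0ℤ))
proposition2 d C 𝓑 v act ashe m M m∈S M∈S m≤M m' M' image =
  Σᶠ-mono image-width ,
  trans (Σᶠ-cong (λ i → spreadBound-split 𝓑 v m M i (m≤M i))) (Σᶠ-+ (λ i → + ∣ M i - m i ∣) _)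
  where
  m∈box : InBox C m M m
  m∈box = m∈S , (λ _ → ≤-refl) , m≤M

  image-width : ∀ i → + ∣ M' i - m' i ∣ ≤ spreadBound 𝓑 v m M i
  image-width i with image i
  ... | inf , sup rewrite 0≤i⇒+∣i∣≡i (image-width-nonneg {act = act} {i = i} inf sup m∈box) =
    image-width-≤ {act = act} {i = i} inf sup (λ x y x∈box y∈box → coordinate-spread ashe i x∈box y∈box)
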